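{- The only nilpotent element of a CM order $\mathcal{O}$ is $0$.
   Context: An order is a commutative unitary ring whose additive group is isomorphic to $\mathbb{Z}^n$. A CM order is an order $\mathcal{O}$ with an involutive ring automorphism $x\mapsto\overline{x}$ such that $x\mapsto\mathrm{tr}(x\overline{x})$ is a positive-definite quadratic form, where $\mathrm{tr}(a)$ is the trace of the endomorphism $x\mapsto ax$. -}

module Defs where

open import Level using (Level; _⊔_) renaming (suc to lsuc)
open import Data.Nat using (ℕ; zero; suc)
open import Data.Fin using (Fin; zero; suc; _≟_)
open import Data.Integer using (ℤ; +_; _+_; -_; _<_)
open import Data.Product using (∃; proj₁)
open import Relation.Nullary using (yes; no)
open import Relation.Binary.PropositionalEquality using (_≡_)
open import Algebra.Bundles using (CommutativeRing; RawGroup)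
import Algebra.Bundles
import Algebra.Morphism.Structures as MS
import Algebra.Definitions.RawSemiring as RawSemiringDefs

ℤ^-rawGroup : ℕ → RawGroup Level.zero Level.zero
ℤ^-rawGroup n = record
  { Carrier = Fin n → ℤ
  ; _≈_     = λ u v → ∀ i → u i ≡ v i
  ; _∙_     = λ u v i → u i + v i
  ; ε       = λ _ → + 0
  ; _⁻¹     = λ u i → - (u i)
  }

unitVec : ∀ {n} → Fin n → Fin n → ℤ
unitVec j i with i ≟ j
... | yes _ = + 1
... | no _  = + 0

sumFin : ∀ n → (Fin n → ℤ) → ℤ
sumFin zero    f = + 0
sumFin (suc n) f = f zero + sumFin n (λ i → f (suc i))

record Order (c ℓ : Level) : Set (lsuc (c ⊔ ℓ)) where
  field
    cring : CommutativeRing c ℓ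
    rank  : ℕ
  open CommutativeRing cring public
  field
    coord    : Carrier → Fin rank → ℤ
    coordIso : MS.GroupMorphisms.IsGroupIsomorphism (Algebra.Bundles.RawRing.+-rawGroup rawRing) (ℤ^-rawGroup rank) coord

  basis : Fin rank → Carrier
  basis j = proj₁ (MS.GroupMorphisms.IsGroupIsomorphism.surjective coordIso (unitVec j))

  -- tr(a) = trace of the ℤ-linear endomorphism x ↦ a x of R ≅ ℤ^rank
  tr : Carrier → ℤ
  tr a = sumFin rank (λ j → coord (a * basis j) j)

  open RawSemiringDefs (Algebra.Bundles.RawRing.rawSemiring rawRing) public using (_^_)

  Nilpotent : Carrier → Set ℓ
  Nilpotent x = ∃ λ (k : ℕ) → x ^ k ≈ 0#

record CMOrder (c ℓ : Level) : Set (lsuc (c ⊔ ℓ)) where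
  field
    order : Order c ℓ
  open Order order public
  field
    conj        : Carrier → Carrier
    conjAuto    : MS.RingMorphisms.IsRingIsomorphism rawRing rawRing conj
    conjInvol   : ∀ x → conj (conj x) ≈ x
    posDefinite : ∀ x → x ≉ 0# → + 0 < tr (x * conj x)

-- If x x̄ = 0 then tr(x x̄) = 0, so x = 0 by positive definiteness. Hence a
-- square-zero x is 0: y = x x̄ satisfies y ȳ = x² x̄² = 0, so y = 0 and then
-- x = 0. Finally, in a ring without nonzero square-zero elements,
-- x^(k+2) = 0 gives (x^(k+1))² = x^(k+2) x^k = 0, so x^(k+1) = 0, and
-- descending on k yields x = 0.
module Submission where

open import Defs
open import Level using (Level)
open import Data.Nat as ℕ using (ℕ; zero; suc)
import Data.Nat.Properties as ℕ
open import Data.Fin as Fin using (Fin)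
open import Data.Fin.Properties using (all?)
open import Data.Integer using (ℤ; +_) renaming (_+_ to _+ℤ_)
import Data.Integer.Properties as ℤ
open import Data.Product using (_,_)
open import Relation.Nullary using (Dec; yes; no; contradiction)
open import Relation.Binary.PropositionalEquality as ≡ using (_≡_)
open import Algebra.Bundles using (Semiring)
import Algebra.Morphism.Structures as MS
import Algebra.Properties.Semiring.Exp as Exp
import Algebra.Properties.CommutativeSemigroup as CommutativeSemigroupProperties
import Relation.Binary.Reasoning.Setoid as SetoidReasoning

sumFin-zero : ∀ n (f : Fin n → ℤ) → (∀ i → f i ≡ + 0) → sumFin n f ≡ + 0
sumFin-zero zero    f f≡0 = ≡.refl
sumFin-zero (suc n) f f≡0 =
  ≡.cong₂ _+ℤ_ (f≡0 Fin.zero) (sumFin-zero n (λ i → f (Fin.suc i)) (λ i → f≡0 (Fin.suc i)))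

module _ {c ℓ : Level} (R : Semiring c ℓ) where
  open Semiring R
  open Exp R using (_^_; ^-homo-*; ^-congʳ)
  open SetoidReasoning setoid

  pow-zero⇒zero : (∀ y → y * y ≈ 0# → y ≈ 0#) → ∀ k x → x ^ k ≈ 0# → x ≈ 0#
  pow-zero⇒zero reduced zero x 1≈0 = begin
    x      ≈⟨ sym (*-identityʳ x) ⟩
    x * 1# ≈⟨ *-congˡ 1≈0 ⟩
    x * 0# ≈⟨ zeroʳ x ⟩
    0#     ∎
  pow-zero⇒zero reduced (suc zero) x x¹≈0 = trans (sym (*-identityʳ x)) x¹≈0
  pow-zero⇒zero reduced (suc (suc k)) x xᵏ⁺²≈0 =
    pow-zero⇒zero reduced (suc k) x (reduced (x ^ suc k) square≈0)
    where
    square≈0 : x ^ suc k * x ^ suc k ≈ 0#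
    square≈0 = begin
      x ^ suc k * x ^ suc k   ≈⟨ sym (^-homo-* x (suc k) (suc k)) ⟩
      x ^ (suc k ℕ.+ suc k)   ≈⟨ ^-congʳ x (ℕ.+-suc (suc k) k) ⟩
      x ^ (suc (suc k) ℕ.+ k) ≈⟨ ^-homo-* x (suc (suc k)) k ⟩
      x ^ suc (suc k) * x ^ k ≈⟨ *-congʳ xᵏ⁺²≈0 ⟩
      0# * x ^ k              ≈⟨ zeroˡ _ ⟩
      0#                      ∎

module _ {c ℓ : Level} (O : Order c ℓ) where
  open Order O
  open MS.GroupMorphisms.IsGroupIsomorphism coordIso using (⟦⟧-cong; ε-homo; injective)

  -- Positive definiteness only speaks about x ≉ 0#; this decision turns it into x ≈ 0#.
  ≈0#? : ∀ x → Dec (x ≈ 0#)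
  ≈0#? x with all? (λ i → coord x i ℤ.≟ coord 0# i)
  ... | yes coords≡ = yes (injective coords≡)
  ... | no  coords≢ = no (λ x≈0 → coords≢ (⟦⟧-cong x≈0))

  tr-zero : ∀ a → a ≈ 0# → tr a ≡ + 0
  tr-zero a a≈0 = sumFin-zero rank _ λ j →
    ≡.trans (⟦⟧-cong (trans (*-congʳ a≈0) (zeroˡ _)) j) (ε-homo j)

module _ {c ℓ : Level} (O : CMOrder c ℓ) where
  open CMOrder O
  open SetoidReasoning setoid
  open CommutativeSemigroupProperties *-commutativeSemigroup using (interchange)
  module Conj = MS.RingMorphisms.IsRingIsomorphism conjAuto

  norm-zero⇒zero : ∀ x → x * conj x ≈ 0# → x ≈ 0#
  norm-zero⇒zero x xx̄≈0 with ≈0#? order x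
  ... | yes x≈0 = x≈0
  ... | no  x≉0 = contradiction (≡.sym (tr-zero order _ xx̄≈0)) (ℤ.<⇒≢ (posDefinite x x≉0))

  square-zero⇒zero : ∀ x → x * x ≈ 0# → x ≈ 0#
  square-zero⇒zero x x²≈0 = norm-zero⇒zero x (norm-zero⇒zero (x * conj x) norm≈0)
    where
    norm≈0 : (x * conj x) * conj (x * conj x) ≈ 0#
    norm≈0 = begin
      (x * conj x) * conj (x * conj x)        ≈⟨ *-congˡ (Conj.*-homo x (conj x)) ⟩
      (x * conj x) * (conj x * conj (conj x)) ≈⟨ *-congˡ (*-congˡ (conjInvol x)) ⟩
      (x * conj x) * (conj x * x)             ≈⟨ *-congˡ (*-comm (conj x) x) ⟩
      (x * conj x) * (x * conj x)             ≈⟨ interchange x (conj x) x (conj x) ⟩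
      (x * x) * (conj x * conj x)             ≈⟨ *-congʳ x²≈0 ⟩
      0# * (conj x * conj x)                  ≈⟨ zeroˡ _ ⟩
      0#                                      ∎

mainTheorem10 : ∀ {c ℓ : Level} (O : CMOrder c ℓ) (x : CMOrder.Carrier O) →
                  CMOrder.Nilpotent O x → CMOrder._≈_ O x (CMOrder.0# O)
mainTheorem10 O x (k , xᵏ≈0) =
  pow-zero⇒zero (CMOrder.semiring O) (square-zero⇒zero O) k x xᵏ≈0
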